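{- Let $t,p$ be positive integers and $k=3^t5^p$. Then there exists a non-$2$-DP-colorable $k$-uniform hypergraph with $2^{k-1}$ edges.
   Context: A $k$-uniform hypergraph $G$ has a finite vertex set $V(G)$ and edge set $E(G)$, a set of $k$-element subsets of $V(G)$. For each $e\in E(G)$ let $\varphi_e:e\to\{0,1\}$ and $\overline{\varphi_e}=\varphi_e\oplus1$; let $\Phi=(\varphi_e)_{e\in E(G)}$. A $2$-coloring $f:V(G)\to\{0,1\}$ avoids $\Phi$ if $f|_e\ne\varphi_e$ and $f|_e\ne\overline{\varphi_e}$ for every $e$. $G$ is $2$-DP-colorable if for every such $\Phi$ some $2$-coloring avoids $\Phi$. -}

module Defs where

open import Data.Nat using (ℕ)
open import Data.Bool using (Bool; not)
open import Data.Fin using (Fin)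
open import Data.Fin.Subset using (Subset; _∈_; ∣_∣)
open import Data.Product using (Σ; _×_)
open import Relation.Binary.PropositionalEquality using (_≡_)
open import Relation.Nullary using (¬_)
open import Function.Definitions using (Injective)

-- A k-uniform hypergraph on vertex set Fin n with m edges:
-- the edge set is given as an injective family of k-element subsets of Fin n
-- (injectivity = the edges are distinct, so |E(G)| = m exactly).
record Hypergraph (k n m : ℕ) : Set where
  field
    edge        : Fin m → Subset n
    uniform     : ∀ i → ∣ edge i ∣ ≡ k
    edge-inj    : Injective _≡_ _≡_ edge

open Hypergraph public

Assignment : ∀ {k n m} → Hypergraph k n m → Set
Assignment {n = n} {m = m} G = (i : Fin m) → (v : Fin n) → v ∈ edge G i → Bool

RestrictEq : ∀ {n} (e : Subset n) → (Fin n → Bool) → ((v : Fin n) → v ∈ e → Bool) → Set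
RestrictEq {n} e f ψ = (v : Fin n) (h : v ∈ e) → f v ≡ ψ v h

Avoids : ∀ {k n m} (G : Hypergraph k n m) → (Fin n → Bool) → Assignment G → Set
Avoids {m = m} G f Φ =
  (i : Fin m) →
    ¬ RestrictEq (edge G i) f (Φ i) ×
    ¬ RestrictEq (edge G i) f (λ v h → not (Φ i v h))

TwoDPColorable : ∀ {k n m} → Hypergraph k n m → Set
TwoDPColorable {n = n} G = (Φ : Assignment G) → Σ (Fin n → Bool) λ f → Avoids G f Φ

-- Call a family of edges, each with its vertices listed in order and carrying a pattern
-- φ e, an obstruction when every 2-colouring agrees on some edge e with φ e or with its
-- complement; the hypergraph it spans is then not 2-DP-colourable. Obstructions multiply.
-- Given a k₁-uniform obstruction A and a k₂-uniform one B, put a copy of B over every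
-- vertex of A; for every edge e of A and every choice of an edge of B in the copy over
-- each vertex v of e, take the union of the chosen edges, patterned by φ e v xor the
-- pattern of the edge chosen over v. A colouring f agrees on some edge of the copy over v
-- with its pattern up to a flip g v; the colouring g agrees on some edge e of A with φ e
-- up to a flip b, and f then agrees with the product edge over e that uses exactly those
-- B-edges, up to the same b. If A and B have 2^(k-1) edges each, the product has
-- 2^(k₁-1) (2^(k₂-1))^k₁ = 2^(k₁k₂-1) edges, so products of a 3-uniform obstruction on
-- 4 vertices and a 5-uniform one on 8 vertices, both checked by exhaustive search, cover
-- k = 3^t 5^p.
module Submission where

open import Defs
open import Data.Nat using (ℕ; zero; suc; _+_; _*_; _^_; _∸_; _<_; z≤n; s≤s; NonZero)
open import Data.Nat.Properties using (^-distribˡ-+-*; ^-*-assoc; *-identityʳ; m^n>0)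
open import Data.Nat.Tactic.RingSolver using (solve-∀)
open import Data.Bool using (Bool; true; false; not; _xor_)
open import Data.Bool.Properties using (xor-assoc; xor-comm; xor-identityʳ; true-xor)
  renaming (_≟_ to _≟ᴮ_)
open import Data.Fin using (Fin; zero; suc; combine; finToFun; funToFin; #_) renaming (_≟_ to _≟ᶠ_)
open import Data.Fin.Properties using (*↔×; funToFin-finToFin; finToFun-funToFin; suc-injective; all?; any?)
open import Data.Fin.Subset using (Subset; _∈_; _∉_; ∣_∣; ⁅_⁆; _∪_; ⊥)
open import Data.Fin.Subset.Properties using (x∈⁅y⁆⇒x≡y; x∈⁅x⁆; x∈p∪q⁻; x∈p∪q⁺; ∉⊥; ∣⊥∣≡0; ∪-identityˡ)
open import Data.Vec using (Vec; []; _∷_; here; there; lookup; tabulate)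
open import Data.Vec.Properties using (lookup∘tabulate)
open import Data.Product using (Σ; ∃; _,_; proj₁; proj₂; _×_)
open import Data.Product.Properties using (,-injectiveˡ; ,-injectiveʳ)
open import Data.Sum using (inj₁; inj₂; [_,_])
open import Data.Empty using (⊥-elim) renaming (⊥ to Empty)
open import Function using (_∘_; _$_)
open import Function.Bundles using (_↔_; _↣_; Inverse; Injection)
open import Function.Properties.Inverse using (↔⇒↣; ↔-sym)
open import Relation.Binary.PropositionalEquality using (_≡_; _≗_; refl; sym; trans; cong; cong₂; subst; module ≡-Reasoning)
open import Relation.Nullary using (¬_; Dec)
open import Relation.Nullary.Decidable using (True; toWitness; map′; _→-dec_; _×-dec_; _⊎-dec_)

open ≡-Reasoning

record Obstruction (Pos V E : Set) : Set where
  field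
    vertex           : E → Pos → V
    vertex-injective : ∀ e {p q} → vertex e p ≡ vertex e q → p ≡ q
    φ                : E → Pos → Bool
    ⊆⇒≡              : ∀ {e e′} → (∀ p → ∃ λ q → vertex e′ q ≡ vertex e p) → e ≡ e′
    unavoidable      : (f : V → Bool) → ∃ λ e → ∃ λ b → ∀ p → f (vertex e p) ≡ φ e p xor b

FinObstruction : ℕ → ℕ → ℕ → Set
FinObstruction k n m = Obstruction (Fin k) (Fin n) (Fin m)

reindex : ∀ {Pos Pos′ V V′ E E′ : Set} →
          Pos′ ↔ Pos → V ↣ V′ → E′ ↔ E → Obstruction Pos V E → Obstruction Pos′ V′ E′
reindex {Pos′ = Pos′} {V′ = V′} {E′ = E′} π ι ε O = record
  { vertex           = vertex′
  ; vertex-injective = λ e → π.injective ∘ O.vertex-injective (ε.to e) ∘ ι.injective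
  ; φ                = λ e p → O.φ (ε.to e) (π.to p)
  ; ⊆⇒≡              = λ H → ε.injective (O.⊆⇒≡ (⊆-transport H))
  ; unavoidable      = unavoidable′
  }
  where
  module O = Obstruction O
  module π = Injection (↔⇒↣ π)
  module π⁻ = Inverse π
  module ε = Injection (↔⇒↣ ε)
  module ε⁻ = Inverse ε
  module ι = Injection ι

  vertex′ : E′ → Pos′ → V′
  vertex′ e p = ι.to (O.vertex (ε.to e) (π.to p))

  ⊆-transport : ∀ {e e′} → (∀ p → ∃ λ q → vertex′ e′ q ≡ vertex′ e p) →
                ∀ p → ∃ λ q → O.vertex (ε.to e′) q ≡ O.vertex (ε.to e) p
  ⊆-transport {e} H p with H (π⁻.from p)
  ... | q , eq = π.to q , ι.injective (subst (λ p′ → vertex′ _ q ≡ ι.to (O.vertex (ε.to e) p′))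
                                              (π⁻.strictlyInverseˡ p) eq)

  unavoidable′ : ∀ f → ∃ λ e → ∃ λ b → ∀ p → f (vertex′ e p) ≡ O.φ (ε.to e) (π.to p) xor b
  unavoidable′ f with O.unavoidable (f ∘ ι.to)
  ... | e , b , agrees = ε⁻.from e , b , λ p →
    subst (λ e₀ → f (ι.to (O.vertex e₀ (π.to p))) ≡ O.φ e₀ (π.to p) xor b)
          (sym (ε⁻.strictlyInverseˡ e)) (agrees (π.to p))

funToFin-cong : ∀ {k m} {c c′ : Fin k → Fin m} → c ≗ c′ → funToFin c ≡ funToFin c′
funToFin-cong {zero}  eq = refl
funToFin-cong {suc k} eq = cong₂ combine (eq zero) (funToFin-cong (eq ∘ suc))

finToFun-injective : ∀ {k m} {z z′ : Fin (m ^ k)} → finToFun z ≗ finToFun z′ → z ≡ z′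
finToFun-injective {k} {m} {z} {z′} eq = begin
  z                               ≡⟨ funToFin-finToFin {k} {m} z ⟨
  funToFin (finToFun {m} {k} z)   ≡⟨ funToFin-cong {k} eq ⟩
  funToFin (finToFun {m} {k} z′)  ≡⟨ funToFin-finToFin {k} {m} z′ ⟩
  z′                              ∎

-- An edge (e , z) of the product is the edge e of A with the B-edge finToFun z j placed
-- over its j-th vertex; B must have a position for the edges of A to be recoverable.
product : ∀ {k₁ m₂ V₁ E₁ Pos₂ V₂} →
          Obstruction (Fin k₁) V₁ E₁ → Obstruction Pos₂ V₂ (Fin m₂) → Pos₂ →
          Obstruction (Fin k₁ × Pos₂) (V₁ × V₂) (E₁ × Fin (m₂ ^ k₁))
product {k₁} {m₂} {V₁} {E₁} {Pos₂} {V₂} A B p₀ = record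
  { vertex           = vertex
  ; vertex-injective = vertex-injective
  ; φ                = φ
  ; ⊆⇒≡              = ⊆⇒≡
  ; unavoidable      = unavoidable
  }
  where
  module A = Obstruction A
  module B = Obstruction B

  Edge : Set
  Edge = E₁ × Fin (m₂ ^ k₁)

  Pos : Set
  Pos = Fin k₁ × Pos₂

  vertex : Edge → Pos → V₁ × V₂
  vertex (e , z) (j , p) = A.vertex e j , B.vertex (finToFun z j) p

  φ : Edge → Pos → Bool
  φ (e , z) (j , p) = A.φ e j xor B.φ (finToFun z j) p

  vertex-injective : ∀ e {p q} → vertex e p ≡ vertex e q → p ≡ q
  vertex-injective (e , z) {j , _} eq with refl ← A.vertex-injective e (,-injectiveˡ eq) =
    cong (j ,_) (B.vertex-injective (finToFun z j) (,-injectiveʳ eq))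

  ⊆⇒≡ : ∀ {x y} → (∀ p → ∃ λ q → vertex y q ≡ vertex x p) → x ≡ y
  ⊆⇒≡ {e , z} {e′ , z′} H
    with refl ← A.⊆⇒≡ (λ j → let (j′ , _) , eq = H (j , p₀) in j′ , ,-injectiveˡ eq)
    = cong (e ,_) (finToFun-injective {k₁} {m₂} λ j → B.⊆⇒≡ (fibre-⊆ j))
    where
    fibre-⊆ : ∀ j p → ∃ λ q → B.vertex (finToFun z′ j) q ≡ B.vertex (finToFun z j) p
    fibre-⊆ j p with H (j , p)
    ... | (j′ , q) , eq with refl ← A.vertex-injective e (,-injectiveˡ eq) = q , ,-injectiveʳ eq

  unavoidable : (f : V₁ × V₂ → Bool) → ∃ λ x → ∃ λ b → ∀ p → f (vertex x p) ≡ φ x p xor b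
  unavoidable f = (e , funToFin choice) , b , agrees
    where
    fibre : ∀ v → ∃ λ i → ∃ λ b → ∀ p → f (v , B.vertex i p) ≡ B.φ i p xor b
    fibre v = B.unavoidable (λ w → f (v , w))

    flip : V₁ → Bool
    flip v = proj₁ (proj₂ (fibre v))

    e : E₁
    e = proj₁ (A.unavoidable flip)

    b : Bool
    b = proj₁ (proj₂ (A.unavoidable flip))

    flip-agrees : ∀ j → flip (A.vertex e j) ≡ A.φ e j xor b
    flip-agrees = proj₂ (proj₂ (A.unavoidable flip))

    choice : Fin k₁ → Fin m₂
    choice j = proj₁ (fibre (A.vertex e j))

    agrees : ∀ p → f (vertex (e , funToFin choice) p) ≡ φ (e , funToFin choice) p xor b
    agrees (j , p) rewrite finToFun-funToFin choice j = begin
      f (v , B.vertex i p)         ≡⟨ proj₂ (proj₂ (fibre v)) p ⟩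
      B.φ i p xor flip v           ≡⟨ cong (B.φ i p xor_) (flip-agrees j) ⟩
      B.φ i p xor (A.φ e j xor b)  ≡⟨ xor-assoc (B.φ i p) _ b ⟨
      (B.φ i p xor A.φ e j) xor b  ≡⟨ cong (_xor b) (xor-comm (B.φ i p) _) ⟩
      (A.φ e j xor B.φ i p) xor b  ∎
      where
      v : V₁
      v = A.vertex e j

      i : Fin m₂
      i = choice j

_⊗_ : ∀ {k₁ n₁ m₁ k₂ n₂ m₂} → FinObstruction k₁ n₁ m₁ → FinObstruction (suc k₂) n₂ m₂ →
      FinObstruction (k₁ * suc k₂) (n₁ * n₂) (m₁ * m₂ ^ k₁)
A ⊗ B = reindex *↔× (↔⇒↣ (↔-sym *↔×)) *↔× (product A B zero)

^-pred-* : ∀ a k₁ k₂ → a ^ (k₁ ∸ 1) * (a ^ k₂) ^ k₁ ≡ a ^ (k₁ * suc k₂ ∸ 1)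
^-pred-* a zero    k₂ = refl
^-pred-* a (suc i) k₂ = begin
  a ^ i * (a ^ k₂) ^ suc i  ≡⟨ cong (a ^ i *_) (^-*-assoc a k₂ (suc i)) ⟩
  a ^ i * a ^ (k₂ * suc i)  ≡⟨ ^-distribˡ-+-* a i (k₂ * suc i) ⟨
  a ^ (i + k₂ * suc i)      ≡⟨ cong (a ^_) (exponent i k₂) ⟩
  a ^ (k₂ + i * suc k₂)     ∎
  where
  exponent : ∀ i k₂ → i + k₂ * suc i ≡ k₂ + i * suc k₂
  exponent = solve-∀

MinimalObstruction : ℕ → Set
MinimalObstruction k = Σ ℕ λ n → FinObstruction k n (2 ^ (k ∸ 1))

minimal-* : ∀ {k₁ k₂} → 0 < k₂ → MinimalObstruction k₁ → MinimalObstruction k₂ → MinimalObstruction (k₁ * k₂)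
minimal-* {k₁} {suc k₂} (s≤s z≤n) (n₁ , A) (n₂ , B) =
  n₁ * n₂ , subst (FinObstruction (k₁ * suc k₂) (n₁ * n₂)) (^-pred-* 2 k₁ k₂) (A ⊗ B)

minimal-^ : ∀ {k} .{{_ : NonZero k}} → MinimalObstruction k → ∀ t → MinimalObstruction (k ^ suc t)
minimal-^ {k} O zero    = subst MinimalObstruction (sym (*-identityʳ k)) O
minimal-^ {k} O (suc t) = minimal-* (m^n>0 k (suc t)) O (minimal-^ O t)

image : ∀ {k n} → (Fin k → Fin n) → Subset n
image {zero}  g = ⊥
image {suc k} g = ⁅ g zero ⁆ ∪ image (g ∘ suc)

∈-image⁻ : ∀ {k n} (g : Fin k → Fin n) {x} → x ∈ image g → ∃ λ j → g j ≡ x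
∈-image⁻ {zero}  g x∈ = ⊥-elim (∉⊥ x∈)
∈-image⁻ {suc k} g x∈ with x∈p∪q⁻ ⁅ g zero ⁆ (image (g ∘ suc)) x∈
... | inj₁ x∈⁅g0⁆ = zero , sym (x∈⁅y⁆⇒x≡y _ x∈⁅g0⁆)
... | inj₂ x∈rest = let j , eq = ∈-image⁻ (g ∘ suc) x∈rest in suc j , eq

∈-image⁺ : ∀ {k n} (g : Fin k → Fin n) j → g j ∈ image g
∈-image⁺ {suc k} g zero    = x∈p∪q⁺ (inj₁ (x∈⁅x⁆ (g zero)))
∈-image⁺ {suc k} g (suc j) = x∈p∪q⁺ {p = ⁅ g zero ⁆} (inj₂ (∈-image⁺ (g ∘ suc) j))

∣⁅x⁆∪p∣≡1+∣p∣ : ∀ {n} (x : Fin n) (p : Subset n) → x ∉ p → ∣ ⁅ x ⁆ ∪ p ∣ ≡ suc ∣ p ∣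
∣⁅x⁆∪p∣≡1+∣p∣ zero    (true ∷ p)  x∉p = ⊥-elim (x∉p here)
∣⁅x⁆∪p∣≡1+∣p∣ zero    (false ∷ p) x∉p = cong (suc ∘ ∣_∣) (∪-identityˡ p)
∣⁅x⁆∪p∣≡1+∣p∣ (suc x) (true ∷ p)  x∉p = cong suc (∣⁅x⁆∪p∣≡1+∣p∣ x p (x∉p ∘ there))
∣⁅x⁆∪p∣≡1+∣p∣ (suc x) (false ∷ p) x∉p = ∣⁅x⁆∪p∣≡1+∣p∣ x p (x∉p ∘ there)

∣image∣ : ∀ {k n} (g : Fin k → Fin n) → (∀ {i j} → g i ≡ g j → i ≡ j) → ∣ image g ∣ ≡ k
∣image∣ {zero} {n} g _ = ∣⊥∣≡0 n
∣image∣ {suc k} g inj = trans (∣⁅x⁆∪p∣≡1+∣p∣ (g zero) (image (g ∘ suc)) g0∉rest)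
                              (cong suc (∣image∣ (g ∘ suc) (suc-injective ∘ inj)))
  where
  g0∉rest : g zero ∉ image (g ∘ suc)
  g0∉rest g0∈ with ∈-image⁻ (g ∘ suc) g0∈
  ... | j , eq with () ← inj eq

hypergraph : ∀ {k n m} → FinObstruction k n m → Hypergraph k n m
hypergraph O = record
  { edge     = image ∘ vertex
  ; uniform  = λ e → ∣image∣ (vertex e) (vertex-injective e)
  ; edge-inj = λ {e} eq → ⊆⇒≡ λ p → ∈-image⁻ _ (subst (vertex e p ∈_) eq (∈-image⁺ (vertex e) p))
  }
  where open Obstruction O

x-xor-true : ∀ x → x xor true ≡ not x
x-xor-true x = trans (xor-comm x true) (true-xor x)

hypergraph-not-2DP : ∀ {k n m} (O : FinObstruction k n m) → ¬ TwoDPColorable (hypergraph O)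
hypergraph-not-2DP {k} {n} O colourable = refute (unavoidable f)
  where
  open Obstruction O

  position : ∀ {e v} → v ∈ image (vertex e) → Fin k
  position {e} v∈ = proj₁ (∈-image⁻ (vertex e) v∈)

  Φ : Assignment (hypergraph O)
  Φ e v v∈ = φ e (position v∈)

  f : Fin n → Bool
  f = proj₁ (colourable Φ)

  avoids : Avoids (hypergraph O) f Φ
  avoids = proj₂ (colourable Φ)

  agrees : ∀ {e b} → (∀ p → f (vertex e p) ≡ φ e p xor b) →
           ∀ v (v∈ : v ∈ image (vertex e)) → f v ≡ φ e (position v∈) xor b
  agrees {e} h v v∈ with ∈-image⁻ (vertex e) v∈
  ... | p , refl = h p

  refute : (∃ λ e → ∃ λ b → ∀ p → f (vertex e p) ≡ φ e p xor b) → Empty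
  refute (e , false , h) = proj₁ (avoids e) λ v v∈ → trans (agrees h v v∈) (xor-identityʳ _)
  refute (e , true  , h) = proj₂ (avoids e) λ v v∈ → trans (agrees h v v∈) (x-xor-true _)

∃-Bool? : ∀ {P : Bool → Set} → (∀ b → Dec (P b)) → Dec (Σ Bool P)
∃-Bool? P? = map′ [ (false ,_) , (true ,_) ] (λ { (false , q) → inj₁ q ; (true , q) → inj₂ q })
                  (P? false ⊎-dec P? true)

∀-Vec-Bool? : ∀ n {P : Vec Bool n → Set} → (∀ v → Dec (P v)) → Dec (∀ v → P v)
∀-Vec-Bool? zero    P? = map′ (λ p → λ { [] → p }) (_$ []) (P? [])
∀-Vec-Bool? (suc n) P? = map′ (λ (t , f) → λ { (true ∷ v) → t v ; (false ∷ v) → f v })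
                              (λ h → h ∘ (true ∷_) , h ∘ (false ∷_))
                              (∀-Vec-Bool? n (P? ∘ (true ∷_)) ×-dec ∀-Vec-Bool? n (P? ∘ (false ∷_)))

module Tabulated {k n m} (table : Vec (Vec (Fin n × Bool) k) m) where
  vertex : Fin m → Fin k → Fin n
  vertex e p = proj₁ (lookup (lookup table e) p)

  φ : Fin m → Fin k → Bool
  φ e p = proj₂ (lookup (lookup table e) p)

  vertex-injective? : Dec (∀ e p q → vertex e p ≡ vertex e q → p ≡ q)
  vertex-injective? = all? λ e → all? λ p → all? λ q → (vertex e p ≟ᶠ vertex e q) →-dec (p ≟ᶠ q)

  ⊆⇒≡? : Dec (∀ e e′ → (∀ p → ∃ λ q → vertex e′ q ≡ vertex e p) → e ≡ e′)
  ⊆⇒≡? = all? λ e → all? λ e′ → (all? λ p → any? λ q → vertex e′ q ≟ᶠ vertex e p) →-dec (e ≟ᶠ e′)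

  unavoidable? : Dec (∀ (f : Vec Bool n) → ∃ λ e → ∃ λ b → ∀ p → lookup f (vertex e p) ≡ φ e p xor b)
  unavoidable? = ∀-Vec-Bool? n λ f → any? λ e → ∃-Bool? λ b → all? λ p → lookup f (vertex e p) ≟ᴮ φ e p xor b

  obstruction : True vertex-injective? → True ⊆⇒≡? → True unavoidable? → FinObstruction k n m
  obstruction inj ⊆ unavoid = record
    { vertex           = vertex
    ; vertex-injective = λ e → toWitness inj e _ _
    ; φ                = φ
    ; ⊆⇒≡              = toWitness ⊆ _ _
    ; unavoidable      = λ f → let e , b , agrees = toWitness unavoid (tabulate f) in
        e , b , λ p → trans (sym (lookup∘tabulate f (vertex e p))) (agrees p)
    }

minimal₃ : MinimalObstruction 3
minimal₃ = 4 , Tabulated.obstruction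
  ( ((# 0 , false) ∷ (# 1 , false) ∷ (# 2 , false) ∷ [])
  ∷ ((# 0 , true)  ∷ (# 1 , false) ∷ (# 3 , false) ∷ [])
  ∷ ((# 0 , false) ∷ (# 2 , true)  ∷ (# 3 , false) ∷ [])
  ∷ ((# 1 , true)  ∷ (# 2 , false) ∷ (# 3 , false) ∷ [])
  ∷ []) _ _ _

minimal₅ : MinimalObstruction 5
minimal₅ = 8 , Tabulated.obstruction
  ( ((# 0 , false) ∷ (# 1 , false) ∷ (# 2 , false) ∷ (# 3 , false) ∷ (# 4 , false) ∷ [])
  ∷ ((# 0 , true)  ∷ (# 1 , false) ∷ (# 2 , false) ∷ (# 5 , false) ∷ (# 7 , false) ∷ [])
  ∷ ((# 1 , false) ∷ (# 2 , true)  ∷ (# 3 , true)  ∷ (# 6 , false) ∷ (# 7 , false) ∷ [])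
  ∷ ((# 0 , false) ∷ (# 1 , true)  ∷ (# 2 , true)  ∷ (# 6 , false) ∷ (# 7 , false) ∷ [])
  ∷ ((# 0 , true)  ∷ (# 3 , false) ∷ (# 5 , true)  ∷ (# 6 , true)  ∷ (# 7 , false) ∷ [])
  ∷ ((# 1 , true)  ∷ (# 2 , false) ∷ (# 3 , false) ∷ (# 4 , false) ∷ (# 6 , false) ∷ [])
  ∷ ((# 0 , true)  ∷ (# 1 , false) ∷ (# 3 , false) ∷ (# 5 , true)  ∷ (# 6 , false) ∷ [])
  ∷ ((# 0 , false) ∷ (# 2 , false) ∷ (# 3 , true)  ∷ (# 6 , false) ∷ (# 7 , false) ∷ [])
  ∷ ((# 0 , false) ∷ (# 1 , true)  ∷ (# 5 , true)  ∷ (# 6 , true)  ∷ (# 7 , false) ∷ [])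
  ∷ ((# 0 , true)  ∷ (# 2 , false) ∷ (# 3 , true)  ∷ (# 5 , true)  ∷ (# 7 , false) ∷ [])
  ∷ ((# 0 , true)  ∷ (# 1 , true)  ∷ (# 3 , false) ∷ (# 4 , true)  ∷ (# 6 , false) ∷ [])
  ∷ ((# 0 , true)  ∷ (# 1 , true)  ∷ (# 2 , true)  ∷ (# 4 , false) ∷ (# 6 , false) ∷ [])
  ∷ ((# 0 , false) ∷ (# 2 , false) ∷ (# 3 , false) ∷ (# 4 , true)  ∷ (# 6 , false) ∷ [])
  ∷ ((# 1 , false) ∷ (# 2 , true)  ∷ (# 3 , false) ∷ (# 5 , false) ∷ (# 7 , false) ∷ [])
  ∷ ((# 1 , true)  ∷ (# 3 , false) ∷ (# 5 , false) ∷ (# 6 , true)  ∷ (# 7 , false) ∷ [])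
  ∷ ((# 0 , true)  ∷ (# 1 , true)  ∷ (# 2 , false) ∷ (# 3 , true)  ∷ (# 5 , false) ∷ [])
  ∷ []) _ _ _

corollary3 : (t p : ℕ) →
    let k = (3 ^ suc t) * (5 ^ suc p) in
    Σ ℕ λ n → Σ (Hypergraph k n (2 ^ (k ∸ 1))) λ G → ¬ TwoDPColorable G
corollary3 t p with minimal-* (m^n>0 5 (suc p)) (minimal-^ minimal₃ t) (minimal-^ minimal₅ p)
... | n , O = n , hypergraph O , hypergraph-not-2DP O
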